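{- Let $q$ be a prime power and $n\ge 2$ an integer. The minimum distance and the stopping distance of the binary code $\mathcal{C}^T(n,q)$ (with respect to the parity-check matrix $H(n,q)^T$) are both $2q$.
   Context: $\mathbb{S}_n(\mathbb{F}_q)$ denotes the set of $n\times n$ symmetric matrices over $\mathbb{F}_q$ (its elements are called points). Two points $S,S'$ are adjacent if $\operatorname{rank}(S-S')=1$. A line is a maximal set of rank $1$: a subset $\mathcal{M}\subseteq\mathbb{S}_n(\mathbb{F}_q)$ such that any two distinct points of $\mathcal{M}$ are adjacent and no point of $\mathbb{S}_n(\mathbb{F}_q)\setminus\mathcal{M}$ is adjacent to every point of $\mathcal{M}$. $H(n,q)$ is the binary matrix with rows indexed by the lines and columns indexed by the points, whose (line, point) entry is $1$ iff the point belongs to the line. $\mathcal{C}^T(n,q)$ is the binary linear code $\{c\in\mathbb{F}_2^{\text{lines}}: H(n,q)^T c=0\}$. For a binary code given as the null space of a parity-check matrix $H$, a stopping set is a set $T$ of coordinate positions such that no row of $H$ has exactly one $1$ among the positions in $T$; the stopping distance is the minimum size of a nonempty stopping set. -}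

module Defs where

open import Level using (0ℓ)
open import Data.Nat using (ℕ; zero; suc; _<_; _≤_)
open import Data.Nat.Divisibility using (_∣_)
open import Data.Bool using (Bool; true; false; if_then_else_)
open import Data.Fin using (Fin; zero; suc)
open import Data.Vec using (Vec; lookup; tabulate)
open import Data.List using (List; []; length)
open import Data.List.Membership.Propositional using (_∈_)
open import Data.List.Relation.Unary.All using (All)
open import Data.List.Relation.Unary.AllPairs using (AllPairs)
open import Data.List.Relation.Unary.Unique.Propositional using (Unique)
open import Data.Product using (Σ; ∃; ∃-syntax; _×_)
open import Relation.Nullary using (¬_)
open import Relation.Binary.PropositionalEquality using (_≡_)
open import Relation.Binary.Definitions using (DecidableEquality)
open import Algebra.Core using (Op₁; Op₂)
open import Algebra.Structures using (IsCommutativeRing)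

record FiniteField : Set₁ where
  field
    Carrier  : Set
    _+_ _*_  : Op₂ Carrier
    -_       : Op₁ Carrier
    0# 1#    : Carrier
    isCommutativeRing : IsCommutativeRing _≡_ _+_ _*_ -_ 0# 1#
    0≢1      : ¬ (0# ≡ 1#)
    inverse  : ∀ x → ¬ (x ≡ 0#) → ∃[ y ] (x * y ≡ 1#)
    _≟_      : DecidableEquality Carrier
    elements : List Carrier
    elements-unique   : Unique elements
    elements-complete : ∀ x → x ∈ elements

  size : ℕ
  size = length elements

module SymmetricMatrices (F : FiniteField) where
  open FiniteField F

  Mat : ℕ → ℕ → Set
  Mat m k = Vec (Vec Carrier k) m

  entry : ∀ {m k} → Mat m k → Fin m → Fin k → Carrier
  entry M i j = lookup (lookup M i) j

  sumF : ∀ r → (Fin r → Carrier) → Carrier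
  sumF zero    f = 0#
  sumF (suc r) f = f zero + sumF r (λ i → f (suc i))

  _·_ : ∀ {m r k} → Mat m r → Mat r k → Mat m k
  _·_ {r = r} A B = tabulate λ i → tabulate λ j → sumF r (λ l → entry A i l * entry B l j)

  _−_ : ∀ {m k} → Mat m k → Mat m k → Mat m k
  A − B = tabulate λ i → tabulate λ j → entry A i j + (- entry B i j)

  RankAtMost : ∀ {m k} → Mat m k → ℕ → Set
  RankAtMost {m} {k} A r = Σ (Mat m r) λ B → Σ (Mat r k) λ C → A ≡ B · C

  HasRank : ∀ {m k} → Mat m k → ℕ → Set
  HasRank A r = RankAtMost A r × (∀ s → s < r → ¬ RankAtMost A s)

  module _ (n : ℕ) where
    -- candidate points: n × n matrices; points of 𝕊_n(F) are the symmetric ones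
    Pt : Set
    Pt = Mat n n

    Symmetric : Pt → Set
    Symmetric M = ∀ i j → entry M i j ≡ entry M j i

    Adjacent : Pt → Pt → Set
    Adjacent S S' = HasRank (S − S') 1

    PtSet : Set
    PtSet = Pt → Bool

    IsLine : PtSet → Set
    IsLine L =
      (∀ S → L S ≡ true → Symmetric S) ×
      (∀ S S' → L S ≡ true → L S' ≡ true → ¬ (S ≡ S') → Adjacent S S') ×
      (∀ P → Symmetric P → L P ≡ false → ¬ (∀ S → L S ≡ true → Adjacent P S))

    DifferentSets : PtSet → PtSet → Set
    DifferentSets L L' = ¬ (∀ P → L P ≡ L' P)

    -- a finite set of lines (a set of coordinate positions of C^T(n,q)),
    -- listed without repetition
    LineSet : List PtSet → Set
    LineSet T = All IsLine T × AllPairs DifferentSets T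

    -- number of lines of T through P (= entry of H(n,q)^T · 1_T at P, over ℕ)
    deg : List PtSet → Pt → ℕ
    deg List.[] P = 0
    deg (L List.∷ T) P = if L P then suc (deg T P) else deg T P

    -- T is the support of a codeword of C^T(n,q) : H(n,q)^T c = 0 over F₂
    IsCodewordSupport : List PtSet → Set
    IsCodewordSupport T = ∀ P → Symmetric P → 2 ∣ deg T P

    IsStoppingSet : List PtSet → Set
    IsStoppingSet T = ∀ P → Symmetric P → ¬ (deg T P ≡ 1)

    MinNonemptySize : (List PtSet → Set) → ℕ → Set
    MinNonemptySize Q d =
      (∃[ T ] (LineSet T × ¬ (T ≡ []) × Q T × length T ≡ d)) ×
      (∀ T → LineSet T → ¬ (T ≡ []) → Q T → d ≤ length T)

    -- minimum distance (min weight of a nonzero codeword = min support size)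
    MinimumDistance : ℕ → Set
    MinimumDistance = MinNonemptySize IsCodewordSupport

    StoppingDistance : ℕ → Set
    StoppingDistance = MinNonemptySize IsStoppingSet

module Submission where

-- The lines of 𝕊ₙ(F_q) are the sets {S + t D | t ∈ F_q} with D a nonzero symmetric matrix of rank one. The key
-- algebraic fact is that if X, Y and Y − X are symmetric of rank one then Y is a multiple of X; hence three pairwise
-- adjacent points are collinear, and two distinct lines meet in at most one point.
--
-- Lower bound: let T be a nonempty stopping set, S a point of a line L₀ ∈ T, and L₁ a second line of T through S
-- (S cannot lie on exactly one line of T). Each point P ≠ S of L₀ lies on a further line of T, distinct points giving
-- distinct lines; with L₀ itself this gives q lines, and likewise q lines for L₁. The two families are disjoint:
-- a common line would make some point ≠ S of L₁ adjacent to S and to a point of L₀, hence a point of L₀. So |T| ≥ 2q.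
--
-- Upper bound: for indices a₀ ≠ a₁, the q lines {x E₀₀ + y E₁₁ | x ∈ F_q} and the q lines {x E₀₀ + y E₁₁ | y ∈ F_q}
-- cover every such grid point exactly twice and no other point, so they support a codeword of weight 2q; and the
-- support of a codeword is always a stopping set.

open import Defs
open import Level using (0ℓ)
open import Data.Nat as ℕ using (ℕ; zero; suc; _≤_)
open import Data.Nat.Divisibility using (_∣_; ∣1⇒≡1; ∣-refl; _∣0)
import Data.Nat.Properties as ℕₚ
open import Data.Integer as ℤ using (ℤ; -[1+_])
import Data.Integer.Properties as ℤₚ
open import Data.Sign as Sign using (Sign)
open import Data.Maybe using (Maybe; just; nothing)
open import Data.Fin as Fin using (Fin; zero; suc)
import Data.Fin.Properties as Finₚ
open import Data.Vec using (Vec; []; _∷_; lookup; tabulate)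
import Data.Vec.Properties as Vecₚ
open import Data.Product using (Σ; ∃; ∃₂; _×_; _,_; proj₁; proj₂)
open import Data.Sum using (_⊎_; inj₁; inj₂)
open import Data.Bool as Bool using (Bool; true; false; if_then_else_)
import Data.Bool.Properties as Boolₚ
open import Data.List as List using (List; []; _∷_; length; _++_)
open import Data.List.Relation.Unary.Unique.Propositional using (Unique)
open import Data.List.Relation.Unary.Any as Any using (here; there)
open import Data.List.Membership.Propositional using (_∈_; lose)
open import Data.List.Membership.Propositional.Properties using (∈-cartesianProductWith⁺; ∈-lookup)
open import Data.List.Relation.Unary.All as All using (All; []; _∷_)
import Data.List.Properties as Listₚ
import Data.List.Relation.Unary.All.Properties as Allₚ
open import Data.List.Relation.Unary.AllPairs as AllPairs using (AllPairs; _∷_)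
import Data.List.Relation.Unary.AllPairs.Properties as AllPairsₚ
open import Data.Empty using (⊥; ⊥-elim)
open import Function using (_∘_)
open import Relation.Nullary using (¬_; yes; no; Dec)
open import Relation.Nullary.Decidable using (¬?; _×-dec_; does; decidable-stable; dec-true)
open import Relation.Binary.Definitions using (DecidableEquality)
open import Relation.Binary.PropositionalEquality as ≡
  using (_≡_; _≢_; refl; sym; trans; cong; cong₂; subst; subst₂; ≢-sym; module ≡-Reasoning)
open import Algebra.Bundles using (CommutativeRing)
open import Algebra.Solver.Ring.AlmostCommutativeRing
  using (_-Raw-AlmostCommutative⟶_; fromCommutativeRing)

-- The ring solver decides equalities of normal forms by computing on coefficients, so the coefficients are taken
-- in ℤ, which maps into every commutative ring.
module IntegerCoefficients {c ℓ} (R : CommutativeRing c ℓ) where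
  open CommutativeRing R renaming (refl to ≈-refl; sym to ≈-sym; trans to ≈-trans)
  open import Algebra.Properties.Ring ring using (-‿distribˡ-*; -‿involutive; -‿+-comm; -0#≈0#)
  open import Algebra.Properties.AbelianGroup +-abelianGroup using (xyx⁻¹≈y)
  open import Algebra.Properties.CommutativeSemigroup *-commutativeSemigroup using (interchange)
  open import Algebra.Properties.Semiring.Mult.TCOptimised semiring using (×-homo-+; ×1-homo-*; 1+×)
    renaming (_×_ to _×ₙ_)
  open import Relation.Binary.Reasoning.Setoid setoid

  fromℤ : ℤ → Carrier
  fromℤ (ℤ.+ n)    = n ×ₙ 1#
  fromℤ -[1+ n ]   = - (suc n ×ₙ 1#)

  private
    sgn : Sign → Carrier
    sgn Sign.+ = 1#
    sgn Sign.- = - 1#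

    ⊖-homo : ∀ m n → fromℤ (m ℤ.⊖ n) ≈ m ×ₙ 1# - n ×ₙ 1#
    ⊖-homo m zero = begin
      fromℤ (m ℤ.⊖ 0)       ≡⟨ ≡.cong fromℤ (ℤₚ.⊖-≥ {m} ℕ.z≤n) ⟩
      fromℤ (ℤ.+ (m ℕ.∸ 0)) ≈⟨ +-identityʳ _ ⟨
      m ×ₙ 1# + 0#          ≈⟨ +-congˡ -0#≈0# ⟨
      m ×ₙ 1# - 0#          ∎
    ⊖-homo zero    (suc n) = ≈-sym (+-identityˡ _)
    ⊖-homo (suc m) (suc n) = begin
      fromℤ (suc m ℤ.⊖ suc n)          ≡⟨ ≡.cong fromℤ (ℤₚ.[1+m]⊖[1+n]≡m⊖n m n) ⟩
      fromℤ (m ℤ.⊖ n)                  ≈⟨ ⊖-homo m n ⟩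
      m ×ₙ 1# - n ×ₙ 1#                ≈⟨ cancel 1# (m ×ₙ 1#) (n ×ₙ 1#) ⟨
      (1# + m ×ₙ 1#) - (1# + n ×ₙ 1#)  ≈⟨ +-cong (1+× m 1#) (-‿cong (1+× n 1#)) ⟨
      suc m ×ₙ 1# - suc n ×ₙ 1#        ∎
      where
      cancel : ∀ a x y → (a + x) - (a + y) ≈ x - y
      cancel a x y = begin
        (a + x) - (a + y)     ≈⟨ +-congˡ (-‿+-comm a y) ⟨
        (a + x) + (- a + - y) ≈⟨ +-assoc (a + x) (- a) (- y) ⟨
        (a + x - a) - y       ≈⟨ +-congʳ (xyx⁻¹≈y a x) ⟩
        x - y                 ∎

    +-homo : ∀ i j → fromℤ (i ℤ.+ j) ≈ fromℤ i + fromℤ j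
    +-homo -[1+ m ] -[1+ n ] = begin
      - (suc (suc (m ℕ.+ n)) ×ₙ 1#)     ≡⟨ ≡.cong (λ k → - (k ×ₙ 1#)) (ℕₚ.+-suc (suc m) n) ⟨
      - ((suc m ℕ.+ suc n) ×ₙ 1#)       ≈⟨ -‿cong (×-homo-+ 1# (suc m) (suc n)) ⟩
      - (suc m ×ₙ 1# + suc n ×ₙ 1#)     ≈⟨ -‿+-comm _ _ ⟨
      - (suc m ×ₙ 1#) + - (suc n ×ₙ 1#) ∎
    +-homo -[1+ m ] (ℤ.+ n)  = ≈-trans (⊖-homo n (suc m)) (+-comm _ _)
    +-homo (ℤ.+ m)  -[1+ n ] = ⊖-homo m (suc n)
    +-homo (ℤ.+ m)  (ℤ.+ n)  = ×-homo-+ 1# m n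

    ◃-homo : ∀ s n → fromℤ (s ℤ.◃ n) ≈ sgn s * (n ×ₙ 1#)
    ◃-homo s      zero    = ≈-sym (zeroʳ _)
    ◃-homo Sign.+ (suc n) = ≈-sym (*-identityˡ _)
    ◃-homo Sign.- (suc n) = ≈-trans (-‿cong (≈-sym (*-identityˡ _))) (-‿distribˡ-* 1# _)

    sgn-homo : ∀ s t → sgn (s Sign.* t) ≈ sgn s * sgn t
    sgn-homo Sign.+ t      = ≈-sym (*-identityˡ _)
    sgn-homo Sign.- Sign.+ = ≈-sym (*-identityʳ _)
    sgn-homo Sign.- Sign.- = ≈-sym (begin
      - 1# * - 1#   ≈⟨ -‿distribˡ-* 1# (- 1#) ⟨
      - (1# * - 1#) ≈⟨ -‿cong (*-identityˡ _) ⟩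
      - - 1#        ≈⟨ -‿involutive 1# ⟩
      1#            ∎)

    sign-abs : ∀ i → fromℤ i ≈ sgn (ℤ.sign i) * (ℤ.∣ i ∣ ×ₙ 1#)
    sign-abs i =
      ≈-trans (reflexive (≡.cong fromℤ (≡.sym (ℤₚ.◃-inverse i)))) (◃-homo (ℤ.sign i) ℤ.∣ i ∣)

    *-homo : ∀ i j → fromℤ (i ℤ.* j) ≈ fromℤ i * fromℤ j
    *-homo i j = begin
      fromℤ (i ℤ.* j)                   ≈⟨ ◃-homo (s Sign.* t) (∣i∣ ℕ.* ∣j∣) ⟩
      sgn (s Sign.* t) * ((∣i∣ ℕ.* ∣j∣) ×ₙ 1#) ≈⟨ *-cong (sgn-homo s t) (×1-homo-* ∣i∣ ∣j∣) ⟩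
      (sgn s * sgn t) * (∣i∣ ×ₙ 1# * ∣j∣ ×ₙ 1#) ≈⟨ interchange _ _ _ _ ⟩
      (sgn s * ∣i∣ ×ₙ 1#) * (sgn t * ∣j∣ ×ₙ 1#) ≈⟨ *-cong (sign-abs i) (sign-abs j) ⟨
      fromℤ i * fromℤ j                 ∎
      where
      s = ℤ.sign i
      t = ℤ.sign j
      ∣i∣ = ℤ.∣ i ∣
      ∣j∣ = ℤ.∣ j ∣

    -‿homo : ∀ i → fromℤ (ℤ.- i) ≈ - fromℤ i
    -‿homo (ℤ.+ zero)  = ≈-sym -0#≈0#
    -‿homo (ℤ.+ suc n) = ≈-refl
    -‿homo -[1+ n ]    = ≈-sym (-‿involutive _)

    homomorphism : ℤ.+-*-rawRing -Raw-AlmostCommutative⟶ fromCommutativeRing R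
    homomorphism = record
      { ⟦_⟧ = fromℤ ; +-homo = +-homo ; *-homo = *-homo ; -‿homo = -‿homo
      ; 0-homo = ≈-refl ; 1-homo = ≈-refl }

    coefficients? : ∀ i j → Maybe (fromℤ i ≈ fromℤ j)
    coefficients? i j with i ℤ.≟ j
    ... | yes ≡.refl = just ≈-refl
    ... | no _       = nothing

  open import Algebra.Solver.Ring ℤ.+-*-rawRing (fromCommutativeRing R) homomorphism coefficients? public
    using (solve; _:=_; _:+_; _:*_; :-_; _:-_; con)

≡true⇔⇒≡ : ∀ {b b′ : Bool} → (b ≡ true → b′ ≡ true) → (b′ ≡ true → b ≡ true) → b ≡ b′
≡true⇔⇒≡ {true}  {_}     to _    = sym (to refl)
≡true⇔⇒≡ {false} {true}  _  from = from refl
≡true⇔⇒≡ {false} {false} _  _    = refl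

allPairs-lookup : ∀ {A : Set} {R : A → A → Set} → (∀ {x y} → R x y → R y x) →
                  ∀ {xs} → AllPairs R xs → ∀ {i j} → i ≢ j → R (List.lookup xs i) (List.lookup xs j)
allPairs-lookup R-sym (_ ∷ _)    {zero}  {zero}  0≢0   = ⊥-elim (0≢0 refl)
allPairs-lookup R-sym (x~ ∷ _)   {zero}  {suc j} _     = All.lookup x~ (∈-lookup j)
allPairs-lookup R-sym (x~ ∷ _)   {suc i} {zero}  _     = R-sym (All.lookup x~ (∈-lookup i))
allPairs-lookup R-sym (_ ∷ xs~) {suc i} {suc j} i+≢j+ =
  allPairs-lookup R-sym xs~ (λ i≡j → i+≢j+ (cong suc i≡j))

allVecs : ∀ {A : Set} → List A → ∀ k → List (Vec A k)
allVecs xs zero    = [] ∷ []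
allVecs xs (suc k) = List.cartesianProductWith _∷_ xs (allVecs xs k)

∈-allVecs : ∀ {A : Set} {xs : List A} → (∀ a → a ∈ xs) → ∀ {k} (v : Vec A k) → v ∈ allVecs xs k
∈-allVecs complete []       = here refl
∈-allVecs complete (a ∷ v) = ∈-cartesianProductWith⁺ _∷_ (complete a) (∈-allVecs complete v)

module FieldProperties (F : FiniteField) where
  open FiniteField F public using (Carrier; _≟_; 0≢1; inverse; elements; elements-complete; elements-unique; size)

  commutativeRing : CommutativeRing 0ℓ 0ℓ
  commutativeRing = record { isCommutativeRing = FiniteField.isCommutativeRing F }

  open CommutativeRing commutativeRing public
    using (_+_; _*_; _-_; 0#; 1#; +-identityˡ; +-identityʳ; *-identityˡ; *-comm; zeroˡ; zeroʳ; -‿inverseʳ)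
  open IntegerCoefficients commutativeRing public
  open import Algebra.Properties.Group (CommutativeRing.+-group commutativeRing)
    using (x∙y⁻¹≈ε⇒x≈y; x≈y⇒x∙y⁻¹≈ε)
  open ≡-Reasoning

  element : Fin size → Carrier
  element = List.lookup elements

  element-injective : ∀ {i j} → element i ≡ element j → i ≡ j
  element-injective {i} {j} eq with i Fin.≟ j
  ... | yes i≡j = i≡j
  ... | no i≢j  = ⊥-elim (allPairs-lookup ≢-sym elements-unique i≢j eq)

  x-y≡0⇒x≡y : ∀ {x y} → x - y ≡ 0# → x ≡ y
  x-y≡0⇒x≡y = x∙y⁻¹≈ε⇒x≈y _ _

  x≡y⇒x-y≡0 : ∀ {x y} → x ≡ y → x - y ≡ 0#
  x≡y⇒x-y≡0 = x≈y⇒x∙y⁻¹≈ε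

  module _ {c : Carrier} (c≢0 : c ≢ 0#) where
    private
      c⁻¹ = proj₁ (inverse c c≢0)

      [c*c⁻¹]*z≡z : ∀ z → (c * c⁻¹) * z ≡ z
      [c*c⁻¹]*z≡z z = trans (cong (_* z) (proj₂ (inverse c c≢0))) (*-identityˡ z)

    *-cancelˡ : ∀ {x y} → c * x ≡ c * y → x ≡ y
    *-cancelˡ {x} {y} cx≡cy = begin
      x             ≡⟨ undo x ⟨
      c⁻¹ * (c * x) ≡⟨ cong (c⁻¹ *_) cx≡cy ⟩
      c⁻¹ * (c * y) ≡⟨ undo y ⟩
      y             ∎
      where
      undo : ∀ z → c⁻¹ * (c * z) ≡ z
      undo z = trans (solve 3 (λ c c⁻¹ z → c⁻¹ :* (c :* z) := (c :* c⁻¹) :* z) refl c c⁻¹ z)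
                     ([c*c⁻¹]*z≡z z)

    divide : ∀ z → ∃ λ y → c * y ≡ z
    divide z = c⁻¹ * z ,
      trans (solve 3 (λ c c⁻¹ z → c :* (c⁻¹ :* z) := (c :* c⁻¹) :* z) refl c c⁻¹ z) ([c*c⁻¹]*z≡z z)

  *-nonzero : ∀ {x y} → x ≢ 0# → y ≢ 0# → x * y ≢ 0#
  *-nonzero {x} {y} x≢0 y≢0 xy≡0 = y≢0 (*-cancelˡ x≢0 (trans xy≡0 (sym (zeroʳ x))))

  x*x≡0⇒x≡0 : ∀ {x} → x * x ≡ 0# → x ≡ 0#
  x*x≡0⇒x≡0 {x} xx≡0 with x ≟ 0#
  ... | yes x≡0 = x≡0
  ... | no x≢0  = ⊥-elim (*-nonzero x≢0 x≢0 xx≡0)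

module Matrices (F : FiniteField) where
  open FieldProperties F
  open SymmetricMatrices F
  open ≡-Reasoning

  entry-tabulate : ∀ {m k} (f : Fin m → Fin k → Carrier) i j →
                   entry {m} {k} (tabulate λ i → tabulate λ j → f i j) i j ≡ f i j
  entry-tabulate f i j =
    trans (cong (λ row → lookup row j) (Vecₚ.lookup∘tabulate _ i)) (Vecₚ.lookup∘tabulate (f i) j)

  ≡-ext : ∀ {m k} {A B : Mat m k} → (∀ i j → entry A i j ≡ entry B i j) → A ≡ B
  ≡-ext {A = A} {B} A≗B = begin
    A                                     ≡⟨ Vecₚ.tabulate∘lookup A ⟨
    tabulate (λ i → lookup A i)           ≡⟨ Vecₚ.tabulate-cong (λ i → row-ext (A≗B i)) ⟩
    tabulate (λ i → lookup B i)           ≡⟨ Vecₚ.tabulate∘lookup B ⟩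
    B                                     ∎
    where
    row-ext : ∀ {k} {u v : Vec Carrier k} → (∀ j → lookup u j ≡ lookup v j) → u ≡ v
    row-ext {u = u} {v} u≗v =
      trans (sym (Vecₚ.tabulate∘lookup u)) (trans (Vecₚ.tabulate-cong u≗v) (Vecₚ.tabulate∘lookup v))

  _≟ₘ_ : ∀ {m k} → DecidableEquality (Mat m k)
  _≟ₘ_ = Vecₚ.≡-dec (Vecₚ.≡-dec _≟_)

  entry-− : ∀ {m k} (A B : Mat m k) i j → entry (A − B) i j ≡ entry A i j - entry B i j
  entry-− A B = entry-tabulate (λ i j → entry A i j - entry B i j)

  Outer : ∀ {m k} → Mat m k → Set
  Outer {m} {k} M =
    Σ (Fin m → Carrier) λ b → Σ (Fin k → Carrier) λ c → ∀ i j → entry M i j ≡ b i * c j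

  NonzeroEntry : ∀ {m k} → Mat m k → Set
  NonzeroEntry M = ∃₂ λ i j → entry M i j ≢ 0#

  MinorsVanish : ∀ {m k} → Mat m k → Set
  MinorsVanish M = ∀ i j k l → entry M i j * entry M k l ≡ entry M i l * entry M k j

  rankAtMost1⇒outer : ∀ {m k} {M : Mat m k} → RankAtMost M 1 → Outer M
  rankAtMost1⇒outer (B , C , refl) =
    (λ i → entry B i zero) , (λ j → entry C zero j) ,
    λ i j → trans (entry-tabulate _ i j) (+-identityʳ _)

  outer⇒rankAtMost1 : ∀ {m k} {M : Mat m k} → Outer M → RankAtMost M 1
  outer⇒rankAtMost1 {M = M} (b , c , M≡bc) = B , C , ≡-ext λ i j → begin
    entry M i j                        ≡⟨ M≡bc i j ⟩
    b i * c j                          ≡⟨ +-identityʳ _ ⟨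
    b i * c j + 0#
      ≡⟨ cong₂ (λ x y → x * y + 0#) (lookup-B i) (Vecₚ.lookup∘tabulate c j) ⟨
    entry B i zero * entry C zero j + 0# ≡⟨ entry-tabulate _ i j ⟨
    entry (B · C) i j                  ∎
    where
    B = tabulate λ i → b i ∷ []
    C = tabulate c ∷ []
    lookup-B : ∀ i → entry B i zero ≡ b i
    lookup-B i = cong (λ row → lookup row zero) (Vecₚ.lookup∘tabulate (λ i → b i ∷ []) i)

  outer⇒minorsVanish : ∀ {m k} {M : Mat m k} → Outer M → MinorsVanish M
  outer⇒minorsVanish {M = M} (b , c , M≡bc) i j k l = begin
    entry M i j * entry M k l ≡⟨ cong₂ _*_ (M≡bc i j) (M≡bc k l) ⟩
    (b i * c j) * (b k * c l) ≡⟨ solve 4 (λ bi cj bk cl → (bi :* cj) :* (bk :* cl) := (bi :* cl) :* (bk :* cj))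
                                   refl (b i) (c j) (b k) (c l) ⟩
    (b i * c l) * (b k * c j) ≡⟨ cong₂ _*_ (M≡bc i l) (M≡bc k j) ⟨
    entry M i l * entry M k j ∎

  rankAtMost0⇒zero : ∀ {m k} {M : Mat m k} → RankAtMost M 0 → ∀ i j → entry M i j ≡ 0#
  rankAtMost0⇒zero (B , C , refl) = entry-tabulate _

  zero⇒rankAtMost0 : ∀ {m k} {M : Mat m k} → (∀ i j → entry M i j ≡ 0#) → RankAtMost M 0
  zero⇒rankAtMost0 M≡0 =
    tabulate (λ _ → []) , [] , ≡-ext λ i j → trans (M≡0 i j) (sym (entry-tabulate _ i j))

  ≢⇒nonzeroEntry : ∀ {m k} {A B : Mat m k} → A ≢ B → NonzeroEntry (A − B)
  ≢⇒nonzeroEntry {A = A} {B} A≢B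
    with Finₚ.any? (λ i → Finₚ.any? (λ j → ¬? (entry (A − B) i j ≟ 0#)))
  ... | yes (i , j , Dij≢0) = i , j , Dij≢0
  ... | no none = ⊥-elim (A≢B (≡-ext λ i j → x-y≡0⇒x≡y (trans (sym (entry-− A B i j))
          (decidable-stable (entry (A − B) i j ≟ 0#) λ Dij≢0 → none (i , j , Dij≢0)))))

  module _ {n : ℕ} where

    adjacent⇒outer : ∀ {P Q} → Adjacent n P Q → Outer (P − Q)
    adjacent⇒outer (P−Q≤1 , _) = rankAtMost1⇒outer P−Q≤1

    adjacent⇒≢ : ∀ {P Q} → Adjacent n P Q → P ≢ Q
    adjacent⇒≢ {P} (_ , minimal) refl =
      minimal 0 (ℕ.s≤s ℕ.z≤n)
        (zero⇒rankAtMost0 λ i j → trans (entry-− P P i j) (-‿inverseʳ (entry P i j)))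

    outer⇒adjacent : ∀ {P Q} → Outer (P − Q) → P ≢ Q → Adjacent n P Q
    outer⇒adjacent outer P≢Q = outer⇒rankAtMost1 outer , minimal
      where
      minimal : ∀ s → s ℕ.< 1 → ¬ RankAtMost _ s
      minimal zero _ P−Q≤0 with ≢⇒nonzeroEntry P≢Q
      ... | i , j , Dij≢0 = Dij≢0 (rankAtMost0⇒zero P−Q≤0 i j)
      minimal (suc _) (ℕ.s≤s ()) _

  module _ {n : ℕ} {X : Mat n n} (symX : Symmetric n X) (minorsX : MinorsVanish X) where
    private
      x = entry X

    symmetric-diagonal : NonzeroEntry X → ∃ λ i → x i i ≢ 0#
    symmetric-diagonal (i , j , xij≢0) = i , λ xii≡0 → *-nonzero xij≢0 xij≢0 (begin
      x i j * x i j ≡⟨ cong (x i j *_) (symX i j) ⟩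
      x i j * x j i ≡⟨ minorsX i j j i ⟩
      x i i * x j j ≡⟨ cong (_* x j j) xii≡0 ⟩
      0# * x j j    ≡⟨ zeroˡ (x j j) ⟩
      0#            ∎)

    symmetric-factor : ∀ i k l → x i i * x k l ≡ x k i * x l i
    symmetric-factor i k l = begin
      x i i * x k l ≡⟨ *-comm _ _ ⟩
      x k l * x i i ≡⟨ minorsX k i i l ⟨
      x k i * x i l ≡⟨ cong (x k i *_) (symX i l) ⟩
      x k i * x l i ∎

  module _ {n : ℕ} {X Y : Mat n n} (minorsX : MinorsVanish X) (minorsY : MinorsVanish Y)
           (minorsY−X : MinorsVanish (Y − X)) where
    private
      x = entry X
      y = entry Y

    mixed-minor : ∀ k l → x k k * y l l + x l l * y k k ≡ x k l * y l k + x l k * y k l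
    mixed-minor k l = begin
      x k k * y l l + x l l * y k k
        ≡⟨ solve 4 (λ xkk xll ykk yll → xkk :* yll :+ xll :* ykk :=
             ykk :* yll :+ xkk :* xll :- (ykk :- xkk) :* (yll :- xll)) refl (x k k) (x l l) (y k k) (y l l) ⟩
      y k k * y l l + x k k * x l l - (y k k - x k k) * (y l l - x l l)
        ≡⟨ cong₂ _-_ (cong₂ _+_ (minorsY k k l l) (minorsX k k l l)) minorsD ⟩
      y k l * y l k + x k l * x l k - (y k l - x k l) * (y l k - x l k)
        ≡⟨ solve 4 (λ xkl xlk ykl ylk → ykl :* ylk :+ xkl :* xlk :- (ykl :- xkl) :* (ylk :- xlk) :=
             xkl :* ylk :+ xlk :* ykl) refl (x k l) (x l k) (y k l) (y l k) ⟩
      x k l * y l k + x l k * y k l ∎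
      where
      d : ∀ i j → entry (Y − X) i j ≡ y i j - x i j
      d = entry-− Y X
      minorsD : (y k k - x k k) * (y l l - x l l) ≡ (y k l - x k l) * (y l k - x l k)
      minorsD = trans (sym (cong₂ _*_ (d k k) (d l l))) (trans (minorsY−X k k l l) (cong₂ _*_ (d k l) (d l k)))

  module _ {n : ℕ} {X Y : Mat n n} (symX : Symmetric n X) (symY : Symmetric n Y)
           (minorsX : MinorsVanish X) (minorsY : MinorsVanish Y) (minorsY−X : MinorsVanish (Y − X)) where
    private
      x = entry X
      y = entry Y
      factorX = symmetric-factor {X = X} symX minorsX
      factorY = symmetric-factor {X = Y} symY minorsY

    -- (x k i * y l j - x l i * y k j)² is x i i * y j j times the difference of the two sides of mixed-minor.
    columns-parallel : ∀ i j k l → x k i * y l j ≡ x l i * y k j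
    columns-parallel i j k l = x-y≡0⇒x≡y (x*x≡0⇒x≡0 (begin
      w * w
        ≡⟨ solve 4 (λ xk xl yk yl → (xk :* yl :- xl :* yk) :* (xk :* yl :- xl :* yk) :=
             (xk :* xk) :* (yl :* yl) :+ (xl :* xl) :* (yk :* yk)
               :- ((xk :* xl) :* (yl :* yk) :+ (xl :* xk) :* (yk :* yl)))
             refl (x k i) (x l i) (y k j) (y l j) ⟩
      (x k i * x k i) * (y l j * y l j) + (x l i * x l i) * (y k j * y k j)
        - ((x k i * x l i) * (y l j * y k j) + (x l i * x k i) * (y k j * y l j))
        ≡⟨ cong₂ _-_
             (cong₂ _+_ (cong₂ _*_ (factorX i k k) (factorY j l l)) (cong₂ _*_ (factorX i l l) (factorY j k k)))
             (cong₂ _+_ (cong₂ _*_ (factorX i k l) (factorY j l k)) (cong₂ _*_ (factorX i l k) (factorY j k l))) ⟨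
      (a * x k k) * (b * y l l) + (a * x l l) * (b * y k k)
        - ((a * x k l) * (b * y l k) + (a * x l k) * (b * y k l))
        ≡⟨ solve 10 (λ a b xkk xll xkl xlk ykk yll ykl ylk →
             (a :* xkk) :* (b :* yll) :+ (a :* xll) :* (b :* ykk)
               :- ((a :* xkl) :* (b :* ylk) :+ (a :* xlk) :* (b :* ykl)) :=
             (a :* b) :* (xkk :* yll :+ xll :* ykk) :- (a :* b) :* (xkl :* ylk :+ xlk :* ykl))
             refl a b (x k k) (x l l) (x k l) (x l k) (y k k) (y l l) (y k l) (y l k) ⟩
      (a * b) * (x k k * y l l + x l l * y k k) - (a * b) * (x k l * y l k + x l k * y k l)
        ≡⟨ x≡y⇒x-y≡0 (cong ((a * b) *_) (mixed-minor {X = X} {Y} minorsX minorsY minorsY−X k l)) ⟩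
      0# ∎))
      where
      a = x i i
      b = y j j
      w = x k i * y l j - x l i * y k j

    -- With a = x i i ≢ 0 and b = y j j ≢ 0 the factor is γ = (y i j)² / (a b).
    proportional : NonzeroEntry X → NonzeroEntry Y → ∃ λ γ → ∀ k l → y k l ≡ γ * x k l
    proportional X≢0 Y≢0 = γ , λ k l → *-cancelˡ c≢0 (begin
      c * y k l
        ≡⟨ solve 3 (λ a b u → (a :* a) :* b :* u := (a :* a) :* (b :* u)) refl a b (y k l) ⟩
      (a * a) * (b * y k l)
        ≡⟨ cong ((a * a) *_) (factorY j k l) ⟩
      (a * a) * (y k j * y l j)
        ≡⟨ solve 3 (λ a u v → (a :* a) :* (u :* v) := (a :* u) :* (a :* v)) refl a (y k j) (y l j) ⟩
      (a * y k j) * (a * y l j)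
        ≡⟨ cong₂ _*_ (columns-parallel i j k i) (columns-parallel i j l i) ⟨
      (x k i * y i j) * (x l i * y i j)
        ≡⟨ solve 3 (λ u v z → (u :* z) :* (v :* z) := (z :* z) :* (u :* v)) refl (x k i) (x l i) (y i j) ⟩
      (y i j * y i j) * (x k i * x l i)
        ≡⟨ cong ((y i j * y i j) *_) (factorX i k l) ⟨
      (y i j * y i j) * (a * x k l)
        ≡⟨ solve 3 (λ z a u → (z :* z) :* (a :* u) := a :* (z :* z) :* u) refl (y i j) a (x k l) ⟩
      a * (y i j * y i j) * x k l
        ≡⟨ cong (_* x k l) cγ≡a[yij]² ⟨
      (c * γ) * x k l
        ≡⟨ solve 3 (λ c γ u → (c :* γ) :* u := c :* (γ :* u)) refl c γ (x k l) ⟩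
      c * (γ * x k l) ∎)
      where
      diagX = symmetric-diagonal {X = X} symX minorsX X≢0
      diagY = symmetric-diagonal {X = Y} symY minorsY Y≢0
      i = proj₁ diagX
      j = proj₁ diagY
      a = x i i
      b = y j j
      c = (a * a) * b
      c≢0 : c ≢ 0#
      c≢0 = *-nonzero (*-nonzero (proj₂ diagX) (proj₂ diagX)) (proj₂ diagY)
      γ = proj₁ (divide c≢0 (a * (y i j * y i j)))
      cγ≡a[yij]² = proj₂ (divide c≢0 (a * (y i j * y i j)))

module Lines (F : FiniteField) (n : ℕ) where
  open FieldProperties F
  open SymmetricMatrices F
  open Matrices F
  open ≡-Reasoning

  _+[_]_ : Pt n → Carrier → Pt n → Pt n
  S +[ t ] D = tabulate λ i → tabulate λ j → entry S i j + t * entry D i j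

  entry-+[] : ∀ S t D i j → entry (S +[ t ] D) i j ≡ entry S i j + t * entry D i j
  entry-+[] S t D = entry-tabulate (λ i j → entry S i j + t * entry D i j)

  S+[0]D≡S : ∀ S D → S +[ 0# ] D ≡ S
  S+[0]D≡S S D = ≡-ext λ i j → trans (entry-+[] S 0# D i j)
    (solve 2 (λ s d → s :+ con (ℤ.+ 0) :* d := s) refl (entry S i j) (entry D i j))

  S+[1][Q−S]≡Q : ∀ S Q → S +[ 1# ] (Q − S) ≡ Q
  S+[1][Q−S]≡Q S Q = ≡-ext λ i j → begin
    entry (S +[ 1# ] (Q − S)) i j             ≡⟨ entry-+[] S 1# (Q − S) i j ⟩
    entry S i j + 1# * entry (Q − S) i j      ≡⟨ cong (λ d → entry S i j + 1# * d) (entry-− Q S i j) ⟩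
    entry S i j + 1# * (entry Q i j - entry S i j)
      ≡⟨ solve 2 (λ s q → s :+ con (ℤ.+ 1) :* (q :- s) := q) refl (entry S i j) (entry Q i j) ⟩
    entry Q i j                               ∎

  [S+[1]D]−S≡D : ∀ S D → (S +[ 1# ] D) − S ≡ D
  [S+[1]D]−S≡D S D = ≡-ext λ i j → begin
    entry ((S +[ 1# ] D) − S) i j                ≡⟨ entry-− (S +[ 1# ] D) S i j ⟩
    entry (S +[ 1# ] D) i j - entry S i j        ≡⟨ cong (_- entry S i j) (entry-+[] S 1# D i j) ⟩
    (entry S i j + 1# * entry D i j) - entry S i j
      ≡⟨ solve 2 (λ s d → (s :+ con (ℤ.+ 1) :* d) :- s := d) refl (entry S i j) (entry D i j) ⟩
    entry D i j                                  ∎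

  +[]-comm : ∀ S s D t D′ → (S +[ s ] D) +[ t ] D′ ≡ (S +[ t ] D′) +[ s ] D
  +[]-comm S s D t D′ = ≡-ext λ i j → begin
    entry ((S +[ s ] D) +[ t ] D′) i j                 ≡⟨ entry-+[] (S +[ s ] D) t D′ i j ⟩
    entry (S +[ s ] D) i j + t * entry D′ i j          ≡⟨ cong (_+ t * entry D′ i j) (entry-+[] S s D i j) ⟩
    (entry S i j + s * entry D i j) + t * entry D′ i j
      ≡⟨ solve 5 (λ a s d t d′ → (a :+ s :* d) :+ t :* d′ := (a :+ t :* d′) :+ s :* d)
           refl (entry S i j) s (entry D i j) t (entry D′ i j) ⟩
    (entry S i j + t * entry D′ i j) + s * entry D i j ≡⟨ cong (_+ s * entry D i j) (entry-+[] S t D′ i j) ⟨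
    entry (S +[ t ] D′) i j + s * entry D i j          ≡⟨ entry-+[] (S +[ t ] D′) s D i j ⟨
    entry ((S +[ t ] D′) +[ s ] D) i j                 ∎

  +[]-injective : ∀ S D → NonzeroEntry D → ∀ {t u} → S +[ t ] D ≡ S +[ u ] D → t ≡ u
  +[]-injective S D (i , j , d≢0) {t} {u} eq = *-cancelˡ d≢0 (begin
    d * t                          ≡⟨ solve 3 (λ s d t → d :* t := (s :+ t :* d) :- s) refl s d t ⟩
    (s + t * d) - s                ≡⟨ cong (_- s) (trans (sym (entry-+[] S t D i j)) (entry-≡ eq)) ⟩
    (s + u * d) - s                ≡⟨ solve 3 (λ s d u → (s :+ u :* d) :- s := d :* u) refl s d u ⟩
    d * u                          ∎)
    where
    s = entry S i j
    d = entry D i j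
    entry-≡ : S +[ t ] D ≡ S +[ u ] D → entry (S +[ t ] D) i j ≡ s + u * d
    entry-≡ eq = trans (cong (λ M → entry M i j) eq) (entry-+[] S u D i j)

  symmetric-+[] : ∀ S t D → Symmetric n S → Symmetric n D → Symmetric n (S +[ t ] D)
  symmetric-+[] S t D symS symD i j = begin
    entry (S +[ t ] D) i j        ≡⟨ entry-+[] S t D i j ⟩
    entry S i j + t * entry D i j ≡⟨ cong₂ (λ a d → a + t * d) (symS i j) (symD i j) ⟩
    entry S j i + t * entry D j i ≡⟨ entry-+[] S t D j i ⟨
    entry (S +[ t ] D) j i        ∎

  symmetric-− : ∀ P Q → Symmetric n P → Symmetric n Q → Symmetric n (P − Q)
  symmetric-− P Q symP symQ i j = begin
    entry (P − Q) i j         ≡⟨ entry-− P Q i j ⟩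
    entry P i j - entry Q i j ≡⟨ cong₂ _-_ (symP i j) (symQ i j) ⟩
    entry P j i - entry Q j i ≡⟨ entry-− P Q j i ⟨
    entry (P − Q) j i         ∎

  +[]-adjacent : ∀ S D → Outer D → ∀ t u → S +[ t ] D ≢ S +[ u ] D →
                 Adjacent n (S +[ t ] D) (S +[ u ] D)
  +[]-adjacent S D (b , c , D≡bc) t u = outer⇒adjacent ((λ i → (t - u) * b i) , c , λ i j → begin
    entry ((S +[ t ] D) − (S +[ u ] D)) i j
      ≡⟨ entry-− (S +[ t ] D) (S +[ u ] D) i j ⟩
    entry (S +[ t ] D) i j - entry (S +[ u ] D) i j
      ≡⟨ cong₂ _-_ (entry-+[] S t D i j) (entry-+[] S u D i j) ⟩
    (entry S i j + t * entry D i j) - (entry S i j + u * entry D i j)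
      ≡⟨ cong (λ d → (entry S i j + t * d) - (entry S i j + u * d)) (D≡bc i j) ⟩
    (entry S i j + t * (b i * c j)) - (entry S i j + u * (b i * c j))
      ≡⟨ solve 5 (λ s t u b c → (s :+ t :* (b :* c)) :- (s :+ u :* (b :* c)) := ((t :- u) :* b) :* c)
           refl (entry S i j) t u (b i) (c j) ⟩
    ((t - u) * b i) * c j
      ∎)

  [P−R]−[Q−R]≡P−Q : ∀ (P Q R : Pt n) → (P − R) − (Q − R) ≡ P − Q
  [P−R]−[Q−R]≡P−Q P Q R = ≡-ext λ i j → begin
    entry ((P − R) − (Q − R)) i j                  ≡⟨ entry-− (P − R) (Q − R) i j ⟩
    entry (P − R) i j - entry (Q − R) i j          ≡⟨ cong₂ _-_ (entry-− P R i j) (entry-− Q R i j) ⟩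
    (entry P i j - entry R i j) - (entry Q i j - entry R i j)
      ≡⟨ solve 3 (λ p q r → (p :- r) :- (q :- r) := p :- q) refl (entry P i j) (entry Q i j) (entry R i j) ⟩
    entry P i j - entry Q i j                      ≡⟨ entry-− P Q i j ⟨
    entry (P − Q) i j                              ∎

  collinear : ∀ S S′ P → Symmetric n S → Symmetric n S′ → Symmetric n P →
              Adjacent n S′ S → Adjacent n P S → Adjacent n P S′ →
              ∃ λ γ → P ≡ S +[ γ ] (S′ − S)
  collinear S S′ P symS symS′ symP S′~S P~S P~S′ = γ , ≡-ext λ i j → begin
    entry P i j
      ≡⟨ solve 2 (λ p s → p := s :+ (p :- s)) refl (entry P i j) (entry S i j) ⟩
    entry S i j + (entry P i j - entry S i j) ≡⟨ cong (entry S i j +_) (sym (entry-− P S i j)) ⟩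
    entry S i j + entry (P − S) i j      ≡⟨ cong (entry S i j +_) (P−S≡γD i j) ⟩
    entry S i j + γ * entry (S′ − S) i j ≡⟨ entry-+[] S γ (S′ − S) i j ⟨
    entry (S +[ γ ] (S′ − S)) i j        ∎
    where
    minors : ∀ Q R → Adjacent n Q R → MinorsVanish (Q − R)
    minors Q R Q~R = outer⇒minorsVanish {M = Q − R} (adjacent⇒outer {P = Q} {R} Q~R)
    nonzero : ∀ Q R → Adjacent n Q R → NonzeroEntry (Q − R)
    nonzero Q R Q~R = ≢⇒nonzeroEntry {A = Q} {R} (adjacent⇒≢ {P = Q} {R} Q~R)
    proportionality =
      proportional {X = S′ − S} {P − S} (symmetric-− S′ S symS′ symS) (symmetric-− P S symP symS)
        (minors S′ S S′~S) (minors P S P~S)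
        (subst (MinorsVanish {n} {n}) (sym ([P−R]−[Q−R]≡P−Q P S′ S)) (minors P S′ P~S′))
        (nonzero S′ S S′~S) (nonzero P S P~S)
    γ = proj₁ proportionality
    P−S≡γD = proj₂ proportionality

  O : Pt n
  O = tabulate λ _ → tabulate λ _ → 0#

  entry-O : ∀ i j → entry O i j ≡ 0#
  entry-O = entry-tabulate (λ _ _ → 0#)

  symmetric-O : Symmetric n O
  symmetric-O i j = trans (entry-O i j) (sym (entry-O j i))

  δ : Fin n → Fin n → Carrier
  δ a i = if does (a Fin.≟ i) then 1# else 0#

  δ-≡ : ∀ a → δ a a ≡ 1#
  δ-≡ a with a Fin.≟ a
  ... | yes _  = refl
  ... | no a≢a = ⊥-elim (a≢a refl)

  δ-≢ : ∀ {a i} → a ≢ i → δ a i ≡ 0#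
  δ-≢ {a} {i} a≢i with a Fin.≟ i
  ... | yes a≡i = ⊥-elim (a≢i a≡i)
  ... | no _    = refl

  unit : Fin n → Pt n
  unit a = tabulate λ i → tabulate λ j → δ a i * δ a j

  entry-unit : ∀ a i j → entry (unit a) i j ≡ δ a i * δ a j
  entry-unit a = entry-tabulate (λ i j → δ a i * δ a j)

  symmetric-unit : ∀ a → Symmetric n (unit a)
  symmetric-unit a i j = trans (entry-unit a i j) (trans (*-comm _ _) (sym (entry-unit a j i)))

  outer-unit : ∀ a → Outer (unit a)
  outer-unit a = δ a , δ a , entry-unit a

  nonzeroEntry-unit : ∀ a → NonzeroEntry (unit a)
  nonzeroEntry-unit a = a , a , λ eq → 0≢1 (begin
    0#                 ≡⟨ eq ⟨
    entry (unit a) a a ≡⟨ entry-unit a a a ⟩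
    δ a a * δ a a      ≡⟨ cong₂ _*_ (δ-≡ a) (δ-≡ a) ⟩
    1# * 1#            ≡⟨ *-identityˡ 1# ⟩
    1#                 ∎)

  entry-+[unit]-≡ : ∀ S t a → entry (S +[ t ] unit a) a a ≡ entry S a a + t
  entry-+[unit]-≡ S t a = begin
    entry (S +[ t ] unit a) a a          ≡⟨ entry-+[] S t (unit a) a a ⟩
    entry S a a + t * entry (unit a) a a ≡⟨ cong (λ e → entry S a a + t * e) (entry-unit a a a) ⟩
    entry S a a + t * (δ a a * δ a a)    ≡⟨ cong (λ d → entry S a a + t * (d * d)) (δ-≡ a) ⟩
    entry S a a + t * (1# * 1#)
      ≡⟨ solve 2 (λ s t → s :+ t :* (con (ℤ.+ 1) :* con (ℤ.+ 1)) := s :+ t) refl (entry S a a) t ⟩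
    entry S a a + t                      ∎

  entry-+[unit]-≢ : ∀ S t {a b} → a ≢ b → entry (S +[ t ] unit a) b b ≡ entry S b b
  entry-+[unit]-≢ S t {a} {b} a≢b = begin
    entry (S +[ t ] unit a) b b          ≡⟨ entry-+[] S t (unit a) b b ⟩
    entry S b b + t * entry (unit a) b b ≡⟨ cong (λ e → entry S b b + t * e) (entry-unit a b b) ⟩
    entry S b b + t * (δ a b * δ a b)    ≡⟨ cong (λ d → entry S b b + t * (d * d)) (δ-≢ a≢b) ⟩
    entry S b b + t * (0# * 0#)
      ≡⟨ solve 2 (λ s t → s :+ t :* (con (ℤ.+ 0) :* con (ℤ.+ 0)) := s) refl (entry S b b) t ⟩
    entry S b b                          ∎

  search : ∀ {P : Pt n → Set} → (∀ M → Dec (P M)) → ∃ P ⊎ (∀ M → ¬ P M)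
  search P? with Any.any? P? (allVecs (allVecs elements n) n)
  ... | yes found = inj₁ (Any.satisfied found)
  ... | no none   = inj₂ λ M PM → none (lose (∈-allVecs (∈-allVecs elements-complete) M) PM)

  module Line {L : PtSet n} (isLine : IsLine n L) where
    symmetric : ∀ S → L S ≡ true → Symmetric n S
    symmetric = proj₁ isLine

    adjacent : ∀ S S′ → L S ≡ true → L S′ ≡ true → S ≢ S′ → Adjacent n S S′
    adjacent = proj₁ (proj₂ isLine)

    maximal : ∀ P → Symmetric n P → L P ≡ false → ¬ (∀ S → L S ≡ true → Adjacent n P S)
    maximal = proj₂ (proj₂ isLine)

    module _ {S S′} (S∈L : L S ≡ true) (S′∈L : L S′ ≡ true) (S′≢S : S′ ≢ S) where

      on-line⇒+[] : ∀ {P} → L P ≡ true → ∃ λ γ → P ≡ S +[ γ ] (S′ − S)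
      on-line⇒+[] {P} P∈L with P ≟ₘ S | P ≟ₘ S′
      ... | yes refl | _        = 0# , sym (S+[0]D≡S S (S′ − S))
      ... | no _     | yes refl = 1# , sym (S+[1][Q−S]≡Q S S′)
      ... | no P≢S   | no P≢S′  = collinear S S′ P (symmetric S S∈L) (symmetric S′ S′∈L) (symmetric P P∈L)
        (adjacent S′ S S′∈L S∈L S′≢S) (adjacent P S P∈L S∈L P≢S) (adjacent P S′ P∈L S′∈L P≢S′)

      -- By maximality: S + γ (S′ − S) is adjacent to every point S + u (S′ − S) of L.
      +[]-on-line : ∀ γ → L (S +[ γ ] (S′ − S)) ≡ true
      +[]-on-line γ with L (S +[ γ ] (S′ − S)) in P∈L
      ... | true  = refl
      ... | false = ⊥-elim (maximal P symP P∈L adjacent-to-all)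
        where
        P = S +[ γ ] (S′ − S)
        symP : Symmetric n P
        symP = symmetric-+[] S γ (S′ − S) (symmetric S S∈L)
                 (symmetric-− S′ S (symmetric S′ S′∈L) (symmetric S S∈L))
        adjacent-to-all : ∀ Q → L Q ≡ true → Adjacent n P Q
        adjacent-to-all Q Q∈L with on-line⇒+[] Q∈L
        ... | u , refl = +[]-adjacent S (S′ − S) (adjacent⇒outer {P = S′} {S} (adjacent S′ S S′∈L S∈L S′≢S)) γ u
                           λ P≡Q → Boolₚ.not-¬ P∈L (trans (cong L P≡Q) Q∈L)

      adjacent-to-two⇒on-line : ∀ {P} → Symmetric n P → Adjacent n P S → Adjacent n P S′ → L P ≡ true
      adjacent-to-two⇒on-line {P} symP P~S P~S′ =
        subst (λ Q → L Q ≡ true) (sym (proj₂ P≡S+γD)) (+[]-on-line (proj₁ P≡S+γD))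
        where
        P≡S+γD = collinear S S′ P (symmetric S S∈L) (symmetric S′ S′∈L) symP
                   (adjacent S′ S S′∈L S∈L S′≢S) P~S P~S′

    -- If L were empty, the zero matrix would be vacuously adjacent to all of L.
    nonempty : ∃ λ S → L S ≡ true
    nonempty with search (λ M → L M Bool.≟ true)
    ... | inj₁ found = found
    ... | inj₂ none  = ⊥-elim (maximal O symmetric-O (Boolₚ.¬-not (none O)) λ S S∈L → ⊥-elim (none S S∈L))

    -- Otherwise S + unit a, which is adjacent to S, would extend L.
    second-point : Fin n → ∀ {S} → L S ≡ true → ∃ λ S′ → L S′ ≡ true × S′ ≢ S
    second-point a {S} S∈L with search (λ M → (L M Bool.≟ true) ×-dec ¬? (M ≟ₘ S))
    ... | inj₁ found = found
    ... | inj₂ none  = ⊥-elim (maximal P symP P∉L adjacent-to-all)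
      where
      P = S +[ 1# ] unit a
      symP : Symmetric n P
      symP = symmetric-+[] S 1# (unit a) (symmetric S S∈L) (symmetric-unit a)
      P≢S : P ≢ S
      P≢S P≡S = 0≢1 (sym (+[]-injective S (unit a) (nonzeroEntry-unit a)
                            (trans P≡S (sym (S+[0]D≡S S (unit a))))))
      P∉L : L P ≡ false
      P∉L = Boolₚ.¬-not λ P∈L → none P (P∈L , P≢S)
      adjacent-to-all : ∀ Q → L Q ≡ true → Adjacent n P Q
      adjacent-to-all Q Q∈L with Q ≟ₘ S
      ... | no Q≢S   = ⊥-elim (none Q (Q∈L , Q≢S))
      ... | yes refl = subst (Adjacent n P) (S+[0]D≡S S (unit a))
        (+[]-adjacent S (unit a) (outer-unit a) 1# 0# λ P≡S+0 → P≢S (trans P≡S+0 (S+[0]D≡S S (unit a))))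

  on-both-lines⇒same-points : ∀ {L L′} → IsLine n L → IsLine n L′ → ∀ {P Q} → Q ≢ P →
                              L P ≡ true → L Q ≡ true → L′ P ≡ true → L′ Q ≡ true →
                              ∀ {Z} → L Z ≡ true → L′ Z ≡ true
  on-both-lines⇒same-points {L′ = L′} isL isL′ Q≢P P∈L Q∈L P∈L′ Q∈L′ Z∈L =
    subst (λ Z → L′ Z ≡ true) (sym (proj₂ Z≡P+γD)) (Line.+[]-on-line isL′ P∈L′ Q∈L′ Q≢P (proj₁ Z≡P+γD))
    where
    Z≡P+γD = Line.on-line⇒+[] isL P∈L Q∈L Q≢P Z∈L

  lines-meet-once : ∀ {L L′} → IsLine n L → IsLine n L′ → DifferentSets n L L′ → ∀ {P Q} → Q ≢ P →
                    L P ≡ true → L Q ≡ true → L′ P ≡ true → L′ Q ≡ true → ⊥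
  lines-meet-once isL isL′ L≠L′ Q≢P P∈L Q∈L P∈L′ Q∈L′ = L≠L′ λ Z → ≡true⇔⇒≡
    (on-both-lines⇒same-points isL isL′ Q≢P P∈L Q∈L P∈L′ Q∈L′)
    (on-both-lines⇒same-points isL′ isL Q≢P P∈L′ Q∈L′ P∈L Q∈L)

  image : (Carrier → Pt n) → PtSet n
  image f P = does (Any.any? (λ t → P ≟ₘ f t) elements)

  ∈-image : ∀ f {P} t → P ≡ f t → image f P ≡ true
  ∈-image f {P} t P≡ft = dec-true (Any.any? (λ t → P ≟ₘ f t) elements) (lose (elements-complete t) P≡ft)

  image-preimage : ∀ f {P} → image f P ≡ true → ∃ λ t → P ≡ f t
  image-preimage f {P} P∈ with Any.any? (λ t → P ≟ₘ f t) elements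
  ... | yes found = Any.satisfied found

  image-isLine : ∀ {f} S D → (∀ t → f t ≡ S +[ t ] D) →
                 Symmetric n S → Symmetric n D → Outer D → NonzeroEntry D → IsLine n (image f)
  image-isLine {f} S D f≡ symS symD outerD D≢0 = symmetric , adjacent , maximal
    where
    on-line : ∀ {P} → image f P ≡ true → ∃ λ t → P ≡ S +[ t ] D
    on-line P∈ with image-preimage f P∈
    ... | t , P≡ft = t , trans P≡ft (f≡ t)

    symmetric : ∀ P → image f P ≡ true → Symmetric n P
    symmetric P P∈ =
      subst (Symmetric n) (sym (proj₂ (on-line P∈))) (symmetric-+[] S (proj₁ (on-line P∈)) D symS symD)

    adjacent : ∀ P Q → image f P ≡ true → image f Q ≡ true → P ≢ Q → Adjacent n P Q
    adjacent P Q P∈ Q∈ P≢Q with on-line P∈ | on-line Q∈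
    ... | t , P≡ | u , Q≡ = subst₂ (Adjacent n) (sym P≡) (sym Q≡)
      (+[]-adjacent S D outerD t u λ eq → P≢Q (trans P≡ (trans eq (sym Q≡))))

    S₁ = S +[ 1# ] D
    S∈ : image f S ≡ true
    S∈ = ∈-image f 0# (trans (sym (S+[0]D≡S S D)) (sym (f≡ 0#)))

    maximal : ∀ P → Symmetric n P → image f P ≡ false → ¬ (∀ Q → image f Q ≡ true → Adjacent n P Q)
    maximal P symP P∉ P~ =
      Boolₚ.not-¬ P∉ (∈-image f γ (trans P≡ (trans (cong (S +[ γ ]_) ([S+[1]D]−S≡D S D)) (sym (f≡ γ)))))
      where
      S₁~S : Adjacent n S₁ S
      S₁~S = subst (Adjacent n S₁) (S+[0]D≡S S D) (+[]-adjacent S D outerD 1# 0#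
        λ eq → 0≢1 (sym (+[]-injective S D D≢0 eq)))
      collinearity = collinear S S₁ P symS (symmetric-+[] S 1# D symS symD) symP S₁~S
        (P~ S S∈) (P~ S₁ (∈-image f 1# (sym (f≡ 1#))))
      γ = proj₁ collinearity
      P≡ = proj₂ collinearity

module Degrees (F : FiniteField) (n : ℕ) where
  open SymmetricMatrices F

  deg-≡0 : ∀ T P → (∀ k → List.lookup T k P ≡ false) → deg n T P ≡ 0
  deg-≡0 []      P none = refl
  deg-≡0 (L ∷ T) P none rewrite none zero = deg-≡0 T P (λ k → none (suc k))

  deg-≡1 : ∀ T P k → List.lookup T k P ≡ true → (∀ k′ → k′ ≢ k → List.lookup T k′ P ≡ false) →
           deg n T P ≡ 1
  deg-≡1 (L ∷ T) P zero    P∈L others rewrite P∈L = cong suc (deg-≡0 T P λ k′ → others (suc k′) λ ())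
  deg-≡1 (L ∷ T) P (suc k) P∈L others rewrite others zero (λ ()) =
    deg-≡1 T P k P∈L λ k′ k′≢k → others (suc k′) (λ k′+≡k+ → k′≢k (Finₚ.suc-injective k′+≡k+))

  another-line : ∀ T P k → List.lookup T k P ≡ true → deg n T P ≢ 1 →
                 ∃ λ k′ → k′ ≢ k × List.lookup T k′ P ≡ true
  another-line T P k P∈L deg≢1
    with Finₚ.any? (λ k′ → ¬? (k′ Fin.≟ k) ×-dec (List.lookup T k′ P Bool.≟ true))
  ... | yes found = found
  ... | no none   =
    ⊥-elim (deg≢1 (deg-≡1 T P k P∈L λ k′ k′≢k → Boolₚ.¬-not λ P∈L′ → none (k′ , k′≢k , P∈L′)))

  deg-++ : ∀ T T′ P → deg n (T ++ T′) P ≡ deg n T P ℕ.+ deg n T′ P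
  deg-++ []      T′ P = refl
  deg-++ (L ∷ T) T′ P with L P
  ... | true  = cong suc (deg-++ T T′ P)
  ... | false = deg-++ T T′ P

  module _ {A : Set} (f : A → PtSet n) (P : Pt n) where

    deg-map-≡0 : ∀ xs → All (λ x → f x P ≡ false) xs → deg n (List.map f xs) P ≡ 0
    deg-map-≡0 []       []              = refl
    deg-map-≡0 (x ∷ xs) (P∉fx ∷ P∉fxs) rewrite P∉fx = deg-map-≡0 xs P∉fxs

    deg-map-≡1 : ∀ {xs x} → Unique xs → x ∈ xs → f x P ≡ true → (∀ x′ → f x′ P ≡ true → x′ ≡ x) →
                 deg n (List.map f xs) P ≡ 1
    deg-map-≡1 {x ∷ xs} (x∉xs ∷ _) (here refl) P∈fx only rewrite P∈fx =
      cong suc (deg-map-≡0 xs (All.map P∉ x∉xs))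
      where
      P∉ : ∀ {x′} → x ≢ x′ → f x′ P ≡ false
      P∉ {x′} x≢x′ = Boolₚ.¬-not λ P∈fx′ → x≢x′ (sym (only x′ P∈fx′))
    deg-map-≡1 {x′ ∷ xs} (x′∉xs ∷ xs!) (there x∈xs) P∈fx only with f x′ P in P∈fx′
    ... | true  = ⊥-elim (All.lookup x′∉xs x∈xs (only x′ P∈fx′))
    ... | false = deg-map-≡1 xs! x∈xs P∈fx only

  codeword⇒stopping : ∀ T → IsCodewordSupport n T → IsStoppingSet n T
  codeword⇒stopping T codeword P symP deg≡1 with ∣1⇒≡1 (subst (2 ∣_) deg≡1 (codeword P symP))
  ... | ()

module LowerBound (F : FiniteField) (n : ℕ) where
  open FieldProperties F
  open SymmetricMatrices F
  open Matrices F
  open Lines F n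
  open Degrees F n

  module Counting (a : Fin n) (T : List (PtSet n)) (lines : All (IsLine n) T)
                  (distinct : AllPairs (DifferentSets n) T) (stop : IsStoppingSet n T)
                  (k₀ : Fin (length T)) where
    private
      m = length T

    line : Fin m → PtSet n
    line = List.lookup T

    isLine : ∀ k → IsLine n (line k)
    isLine k = All.lookup lines (∈-lookup k)

    on-line-≡ : ∀ {k k′ P} → k ≡ k′ → line k P ≡ true → line k′ P ≡ true
    on-line-≡ {P = P} = subst (λ k → line k P ≡ true)

    meet-once : ∀ {k k′} → k ≢ k′ → ∀ {P Q} → Q ≢ P →
                line k P ≡ true → line k Q ≡ true → line k′ P ≡ true → line k′ Q ≡ true → ⊥
    meet-once k≢k′ = lines-meet-once (isLine _) (isLine _)
      (allPairs-lookup (λ L≠L′ L′≗L → L≠L′ λ P → sym (L′≗L P)) distinct k≢k′)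

    module Transversals (k : Fin m) {S : Pt n} (S∈L : line k S ≡ true) where
      private
        second = Line.second-point (isLine k) a S∈L
        S′ = proj₁ second
        S′∈L = proj₁ (proj₂ second)
        S′≢S = proj₂ (proj₂ second)

      X : Carrier → Pt n
      X t = S +[ t ] (S′ − S)

      X-on-line : ∀ t → line k (X t) ≡ true
      X-on-line = Line.+[]-on-line (isLine k) S∈L S′∈L S′≢S

      symmetric-X : ∀ t → Symmetric n (X t)
      symmetric-X t = Line.symmetric (isLine k) (X t) (X-on-line t)

      X-injective : ∀ {t u} → X t ≡ X u → t ≡ u
      X-injective = +[]-injective S (S′ − S) (≢⇒nonzeroEntry {A = S′} {S} S′≢S)

      X≢S : ∀ {t} → t ≢ 0# → X t ≢ S
      X≢S t≢0 Xt≡S = t≢0 (X-injective (trans Xt≡S (sym (S+[0]D≡S S (S′ − S)))))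

      -- transversal 0# is line k itself; for t ≢ 0 the stopping-set condition at X t provides another line of T
      -- through X t.
      private
        transversal-line : ∀ t → Dec (t ≡ 0#) →
                    Σ (Fin m) λ k′ → line k′ (X t) ≡ true × (k′ ≡ k → t ≡ 0#) × (t ≡ 0# → k′ ≡ k)
        transversal-line t (yes t≡0) = k , X-on-line t , (λ _ → t≡0) , (λ _ → refl)
        transversal-line t (no t≢0) with another-line T (X t) k (X-on-line t) (stop (X t) (symmetric-X t))
        ... | k′ , k′≢k , Xt∈L′ = k′ , Xt∈L′ , (λ k′≡k → ⊥-elim (k′≢k k′≡k)) , λ t≡0 → ⊥-elim (t≢0 t≡0)

      transversal : Carrier → Fin m
      transversal t = proj₁ (transversal-line t (t ≟ 0#))

      transversal-through : ∀ t → line (transversal t) (X t) ≡ true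
      transversal-through t = proj₁ (proj₂ (transversal-line t (t ≟ 0#)))

      transversal≡k⇒≡0 : ∀ {t} → transversal t ≡ k → t ≡ 0#
      transversal≡k⇒≡0 {t} = proj₁ (proj₂ (proj₂ (transversal-line t (t ≟ 0#))))

      ≡0⇒transversal≡k : ∀ {t} → t ≡ 0# → transversal t ≡ k
      ≡0⇒transversal≡k {t} = proj₂ (proj₂ (proj₂ (transversal-line t (t ≟ 0#))))

      transversal-injective : ∀ {t u} → transversal t ≡ transversal u → t ≡ u
      transversal-injective {t} {u} eq with t ≟ u | transversal t Fin.≟ k
      ... | yes t≡u | _         = t≡u
      ... | no _    | yes tt≡k  =
        trans (transversal≡k⇒≡0 tt≡k) (sym (transversal≡k⇒≡0 (trans (sym eq) tt≡k)))
      ... | no t≢u  | no tt≢k   = ⊥-elim (meet-once tt≢k (λ Xu≡Xt → t≢u (sym (X-injective Xu≡Xt)))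
          (transversal-through t) (on-line-≡ (sym eq) (transversal-through u)) (X-on-line t) (X-on-line u))

    private
      start = Line.nonempty (isLine k₀)
      S = proj₁ start
      S∈L₀ = proj₂ start
      branch = another-line T S k₀ S∈L₀ (stop S (Line.symmetric (isLine k₀) S S∈L₀))
      k₁ = proj₁ branch
      k₁≢k₀ = proj₁ (proj₂ branch)
      S∈L₁ = proj₂ (proj₂ branch)

    module Tr₀ = Transversals k₀ S∈L₀
    module Tr₁ = Transversals k₁ S∈L₁

    not-on-both : ∀ {P} → P ≢ S → line k₀ P ≡ true → line k₁ P ≡ true → ⊥
    not-on-both P≢S P∈L₀ P∈L₁ = meet-once (≢-sym k₁≢k₀) P≢S S∈L₀ P∈L₀ S∈L₁ P∈L₁

    transversals-disjoint : ∀ t u → Tr₀.transversal t ≢ Tr₁.transversal u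
    transversals-disjoint t u eq = by-cases (t ≟ 0#) (u ≟ 0#)
      where
      by-cases : Dec (t ≡ 0#) → Dec (u ≡ 0#) → ⊥
      by-cases (yes t≡0) (yes u≡0) =
        k₁≢k₀ (trans (sym (Tr₁.≡0⇒transversal≡k u≡0)) (trans (sym eq) (Tr₀.≡0⇒transversal≡k t≡0)))
      by-cases (yes t≡0) (no u≢0)  = not-on-both (Tr₁.X≢S u≢0)
        (on-line-≡ (trans (sym eq) (Tr₀.≡0⇒transversal≡k t≡0)) (Tr₁.transversal-through u)) (Tr₁.X-on-line u)
      by-cases (no t≢0)  (yes u≡0) = not-on-both (Tr₀.X≢S t≢0)
        (Tr₀.X-on-line t) (on-line-≡ (trans eq (Tr₁.≡0⇒transversal≡k u≡0)) (Tr₀.transversal-through t))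
      by-cases (no t≢0)  (no u≢0)  = not-on-both (Tr₁.X≢S u≢0) Xu∈L₀ (Tr₁.X-on-line u)
        where
        -- Tr₁.X u is adjacent to S (along L₁) and to Tr₀.X t (along their common line), hence lies on L₀.
        Xu∈L₀ : line k₀ (Tr₁.X u) ≡ true
        Xu∈L₀ = on-L₀ (Tr₀.X t ≟ₘ Tr₁.X u)
          where
          on-L₀ : Dec (Tr₀.X t ≡ Tr₁.X u) → line k₀ (Tr₁.X u) ≡ true
          on-L₀ (yes Xt≡Xu) = subst (λ P → line k₀ P ≡ true) Xt≡Xu (Tr₀.X-on-line t)
          on-L₀ (no Xt≢Xu)  = Line.adjacent-to-two⇒on-line (isLine k₀) S∈L₀ (Tr₀.X-on-line t) (Tr₀.X≢S t≢0)
            (Tr₁.symmetric-X u)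
            (Line.adjacent (isLine k₁) (Tr₁.X u) S (Tr₁.X-on-line u) S∈L₁ (Tr₁.X≢S u≢0))
            (Line.adjacent (isLine (Tr₀.transversal t)) (Tr₁.X u) (Tr₀.X t)
              (on-line-≡ (sym eq) (Tr₁.transversal-through u)) (Tr₀.transversal-through t) (≢-sym Xt≢Xu))

    2q≤m : size ℕ.+ size ≤ m
    2q≤m = Finₚ.injective⇒≤ {f = pick ∘ split} λ {x} {y} eq → begin
      x                            ≡⟨ Finₚ.join-splitAt size size x ⟨
      Fin.join size size (split x) ≡⟨ cong (Fin.join size size) (pick-injective (split x) (split y) eq) ⟩
      Fin.join size size (split y) ≡⟨ Finₚ.join-splitAt size size y ⟩
      y                            ∎
      where
      open ≡-Reasoning
      split = Fin.splitAt size {size}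

      pick : Fin size ⊎ Fin size → Fin m
      pick (inj₁ i) = Tr₀.transversal (element i)
      pick (inj₂ i) = Tr₁.transversal (element i)

      pick-injective : ∀ x y → pick x ≡ pick y → x ≡ y
      pick-injective (inj₁ i) (inj₁ j) eq = cong inj₁ (element-injective (Tr₀.transversal-injective eq))
      pick-injective (inj₁ i) (inj₂ j) eq = ⊥-elim (transversals-disjoint (element i) (element j) eq)
      pick-injective (inj₂ i) (inj₁ j) eq = ⊥-elim (transversals-disjoint (element j) (element i) (sym eq))
      pick-injective (inj₂ i) (inj₂ j) eq = cong inj₂ (element-injective (Tr₁.transversal-injective eq))

  stopping-set-size : Fin n → ∀ T → LineSet n T → T ≢ [] → IsStoppingSet n T →
                      2 ℕ.* size ≤ length T
  stopping-set-size a []      _                   T≢[] _    = ⊥-elim (T≢[] refl)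
  stopping-set-size a (L ∷ T) (lines , distinct) _    stop =
    subst (_≤ length (L ∷ T)) (cong (size ℕ.+_) (sym (ℕₚ.+-identityʳ size)))
      (Counting.2q≤m a (L ∷ T) lines distinct stop zero)

module GridCode (F : FiniteField) (n : ℕ) {a₀ a₁ : Fin n} (a₀≢a₁ : a₀ ≢ a₁) where
  open FieldProperties F
  open SymmetricMatrices F
  open Matrices F
  open Lines F n
  open Degrees F n
  open ≡-Reasoning

  grid : Carrier → Carrier → Pt n
  grid x y = (O +[ y ] unit a₁) +[ x ] unit a₀

  grid-swap : ∀ x y → grid x y ≡ (O +[ x ] unit a₀) +[ y ] unit a₁
  grid-swap x y = +[]-comm O y (unit a₁) x (unit a₀)

  horizontal : Carrier → PtSet n
  horizontal y = image λ x → grid x y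

  vertical : Carrier → PtSet n
  vertical x = image λ y → grid x y

  grid-a₀ : ∀ x y → entry (grid x y) a₀ a₀ ≡ x
  grid-a₀ x y = begin
    entry (grid x y) a₀ a₀             ≡⟨ entry-+[unit]-≡ (O +[ y ] unit a₁) x a₀ ⟩
    entry (O +[ y ] unit a₁) a₀ a₀ + x ≡⟨ cong (_+ x) (entry-+[unit]-≢ O y (≢-sym a₀≢a₁)) ⟩
    entry O a₀ a₀ + x                  ≡⟨ cong (_+ x) (entry-O a₀ a₀) ⟩
    0# + x                             ≡⟨ +-identityˡ x ⟩
    x                                  ∎

  grid-a₁ : ∀ x y → entry (grid x y) a₁ a₁ ≡ y
  grid-a₁ x y = begin
    entry (grid x y) a₁ a₁         ≡⟨ entry-+[unit]-≢ (O +[ y ] unit a₁) x a₀≢a₁ ⟩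
    entry (O +[ y ] unit a₁) a₁ a₁ ≡⟨ entry-+[unit]-≡ O y a₁ ⟩
    entry O a₁ a₁ + y              ≡⟨ cong (_+ y) (entry-O a₁ a₁) ⟩
    0# + y                         ≡⟨ +-identityˡ y ⟩
    y                              ∎

  OnGrid : Pt n → Set
  OnGrid P = P ≡ grid (entry P a₀ a₀) (entry P a₁ a₁)

  grid-coordinates : ∀ {P x y} → P ≡ grid x y → OnGrid P × x ≡ entry P a₀ a₀ × y ≡ entry P a₁ a₁
  grid-coordinates {P} {x} {y} P≡ = trans P≡ (cong₂ grid x≡ y≡) , x≡ , y≡
    where
    x≡ = sym (trans (cong (λ M → entry M a₀ a₀) P≡) (grid-a₀ x y))
    y≡ = sym (trans (cong (λ M → entry M a₁ a₁) P≡) (grid-a₁ x y))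

  horizontal-∋ : ∀ {y P} → horizontal y P ≡ true → OnGrid P × y ≡ entry P a₁ a₁
  horizontal-∋ {y} P∈ with image-preimage (λ x → grid x y) P∈
  ... | x , P≡ = proj₁ (grid-coordinates P≡) , proj₂ (proj₂ (grid-coordinates P≡))

  vertical-∋ : ∀ {x P} → vertical x P ≡ true → OnGrid P × x ≡ entry P a₀ a₀
  vertical-∋ {x} P∈ with image-preimage (λ y → grid x y) P∈
  ... | y , P≡ = proj₁ (grid-coordinates P≡) , proj₁ (proj₂ (grid-coordinates P≡))

  horizontals verticals grid-lines : List (PtSet n)
  horizontals = List.map horizontal elements
  verticals   = List.map vertical elements
  grid-lines  = horizontals ++ verticals

  grid-lines-codeword : IsCodewordSupport n grid-lines
  grid-lines-codeword P _ =
    subst (2 ∣_) (sym (deg-++ horizontals verticals P)) (parity (P ≟ₘ grid (entry P a₀ a₀) (entry P a₁ a₁)))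
    where
    parity : Dec (OnGrid P) → 2 ∣ deg n horizontals P ℕ.+ deg n verticals P
    parity (yes onGrid) = subst (2 ∣_) (sym (cong₂ ℕ._+_
      (deg-map-≡1 horizontal P elements-unique (elements-complete _) (∈-image _ (entry P a₀ a₀) onGrid)
        λ _ P∈ → proj₂ (horizontal-∋ P∈))
      (deg-map-≡1 vertical P elements-unique (elements-complete _) (∈-image _ (entry P a₁ a₁) onGrid)
        λ _ P∈ → proj₂ (vertical-∋ P∈)))) ∣-refl
    parity (no offGrid) = subst (2 ∣_) (sym (cong₂ ℕ._+_
      (deg-map-≡0 horizontal P elements (All.tabulate λ _ → Boolₚ.¬-not λ P∈ → offGrid (proj₁ (horizontal-∋ P∈))))
      (deg-map-≡0 vertical P elements (All.tabulate λ _ → Boolₚ.¬-not λ P∈ → offGrid (proj₁ (vertical-∋ P∈)))))) (2 ∣0)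

  horizontal-isLine : ∀ y → IsLine n (horizontal y)
  horizontal-isLine y = image-isLine (O +[ y ] unit a₁) (unit a₀) (λ _ → refl)
    (symmetric-+[] O y (unit a₁) symmetric-O (symmetric-unit a₁)) (symmetric-unit a₀)
    (outer-unit a₀) (nonzeroEntry-unit a₀)

  vertical-isLine : ∀ x → IsLine n (vertical x)
  vertical-isLine x = image-isLine (O +[ x ] unit a₀) (unit a₁) (grid-swap x)
    (symmetric-+[] O x (unit a₀) symmetric-O (symmetric-unit a₀)) (symmetric-unit a₁)
    (outer-unit a₁) (nonzeroEntry-unit a₁)

  horizontal-distinct : ∀ {y y′} → y ≢ y′ → DifferentSets n (horizontal y) (horizontal y′)
  horizontal-distinct {y} {y′} y≢y′ same =
    y≢y′ (sym (trans (proj₂ (horizontal-∋ {y′} on-y′)) (grid-a₁ 0# y)))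
    where
    on-y′ : horizontal y′ (grid 0# y) ≡ true
    on-y′ = trans (sym (same (grid 0# y))) (∈-image _ 0# refl)

  vertical-distinct : ∀ {x x′} → x ≢ x′ → DifferentSets n (vertical x) (vertical x′)
  vertical-distinct {x} {x′} x≢x′ same =
    x≢x′ (sym (trans (proj₂ (vertical-∋ {x′} on-x′)) (grid-a₀ x 0#)))
    where
    on-x′ : vertical x′ (grid x 0#) ≡ true
    on-x′ = trans (sym (same (grid x 0#))) (∈-image _ 0# refl)

  horizontal≠vertical : ∀ y x → DifferentSets n (horizontal y) (vertical x)
  horizontal≠vertical y x same = 0≢1 (begin
    0#             ≡⟨ -‿inverseʳ x ⟨
    x - x          ≡⟨ cong (_- x) x≡x+1 ⟩
    (x + 1#) - x   ≡⟨ solve 2 (λ x o → (x :+ o) :- x := o) refl x 1# ⟩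
    1#             ∎)
    where
    on-x : vertical x (grid (x + 1#) y) ≡ true
    on-x = trans (sym (same (grid (x + 1#) y))) (∈-image _ (x + 1#) refl)
    x≡x+1 : x ≡ x + 1#
    x≡x+1 = trans (proj₂ (vertical-∋ {x} on-x)) (grid-a₀ (x + 1#) y)

  grid-lines-lineSet : LineSet n grid-lines
  grid-lines-lineSet =
    Allₚ.++⁺ (Allₚ.map⁺ {xs = elements} (All.tabulate λ {y} _ → horizontal-isLine y))
             (Allₚ.map⁺ {xs = elements} (All.tabulate λ {x} _ → vertical-isLine x)) ,
    AllPairsₚ.++⁺ (AllPairsₚ.map⁺ (AllPairs.map horizontal-distinct elements-unique))
                  (AllPairsₚ.map⁺ (AllPairs.map vertical-distinct elements-unique))
                  (Allₚ.map⁺ (All.tabulate λ {y} _ → Allₚ.map⁺ (All.tabulate λ {x} _ → horizontal≠vertical y x)))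

  grid-lines-nonempty : grid-lines ≢ []
  grid-lines-nonempty = nonempty (elements-complete 0#)
    where
    nonempty : ∀ {xs x} → x ∈ xs → List.map horizontal xs ++ List.map vertical xs ≢ []
    nonempty (here _)  ()
    nonempty (there _) ()

  grid-lines-length : length grid-lines ≡ 2 ℕ.* size
  grid-lines-length = begin
    length grid-lines                              ≡⟨ Listₚ.length-++ horizontals ⟩
    length horizontals ℕ.+ length verticals        ≡⟨ cong₂ ℕ._+_ (Listₚ.length-map horizontal elements)
                                                                 (Listₚ.length-map vertical elements) ⟩
    size ℕ.+ size                                  ≡⟨ cong (size ℕ.+_) (ℕₚ.+-identityʳ size) ⟨
    2 ℕ.* size                                     ∎

open import Data.Nat using (_*_)

theorem3 : (F : FiniteField) (n : ℕ) → 2 ≤ n →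
    SymmetricMatrices.MinimumDistance F n (2 * FiniteField.size F) ×
    SymmetricMatrices.StoppingDistance F n (2 * FiniteField.size F)
theorem3 F (suc (suc n)) (ℕ.s≤s (ℕ.s≤s ℕ.z≤n)) =
  ((grid-lines , grid-lines-lineSet , grid-lines-nonempty , grid-lines-codeword , grid-lines-length) ,
   λ T lineSet T≢[] codeword → stopping-set-size zero T lineSet T≢[] (codeword⇒stopping T codeword)) ,
  ((grid-lines , grid-lines-lineSet , grid-lines-nonempty , codeword⇒stopping grid-lines grid-lines-codeword ,
    grid-lines-length) ,
   λ T lineSet T≢[] stopping → stopping-set-size zero T lineSet T≢[] stopping)
  where
  open Degrees F (suc (suc n)) using (codeword⇒stopping)
  open LowerBound F (suc (suc n)) using (stopping-set-size)
  open GridCode F (suc (suc n)) {zero} {suc zero} (λ ())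
    using (grid-lines; grid-lines-lineSet; grid-lines-nonempty; grid-lines-codeword; grid-lines-length)
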